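{- In the $F_3$ Black Hole Zeckendorf game, if $a\equiv 2\pmod 3$ then $(a,0)$ is an $N$ position, and if $b\equiv 2\pmod 3$ then $(0,b)$ is an $N$ position (with $a,b\in\mathbb{Z}_{\ge0}$).
   Context: The $F_3$ Black Hole Zeckendorf game: a position is a pair $(a,b)$ of nonnegative integers, the numbers of pieces in the columns of weight $F_1=1$ and $F_2=2$. Two players alternate moves; the available moves are: (merge) if $a\ge 2$, go to $(a-2,b+1)$; (add) if $a\ge1,b\ge1$, go to $(a-1,b-1)$; (split) if $b\ge 2$, go to $(a+1,b-2)$ (pieces landing in column $F_3$, the "black hole", are removed). The player making the last move wins. A position is a $P$ position if the player to move from it loses under optimal play, and an $N$ position if the player to move can force a win; positions with no move are $P$ positions. -}

module Defs where

open import Data.Nat using (ℕ; zero; suc; _+_)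
open import Data.Product using (_×_; _,_; ∃)

-- A position (a , b): a pieces in column F₁ = 1, b pieces in column F₂ = 2.
Position : Set
Position = ℕ × ℕ

data Move : Position → Position → Set where
  merge : ∀ {a b} → Move (suc (suc a) , b) (a , suc b)
  add   : ∀ {a b} → Move (suc a , suc b) (a , b)
  split : ∀ {a b} → Move (a , suc (suc b)) (suc a , b)

data IsP : Position → Set
data IsN : Position → Set

data IsP where
  isP : ∀ {p} → (∀ {q} → Move p q → IsN q) → IsP p

data IsN where
  isN : ∀ {p q} → Move p q → IsP q → IsN p

{-# OPTIONS --safe #-}
-- Let K be the set of positions (a , b) with (a mod 3 , b mod 3) one of (0,0), (0,1), (1,0).
-- Modulo 3 every move shifts both residues by +1 (merge, split) or -1 (add), and no two
-- of these residue pairs differ by such a diagonal shift, so no move joins two positions of K;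
-- conversely every position outside K has a move into K.  As every move removes a piece,
-- K is therefore the kernel of the game graph, i.e. exactly the set of P positions,
-- and (a , 0), (0 , b) with a ≡ 2, b ≡ 2 (mod 3) lie outside it.
module Submission where

open import Defs
open import Data.Nat using (ℕ; suc; _+_; _%_; _<_; s≤s)
open import Data.Nat.Induction using (<-wellFounded)
open import Data.Nat.Properties using (+-suc; ≤-reflexive; +-monoʳ-<; n<1+n; m<n⇒m<1+n)
open import Data.Empty using (⊥-elim)
open import Data.Product using (_×_; _,_; ∃-syntax)
open import Data.Sum using (_⊎_; inj₁; inj₂)
import Data.Sum as Sum
open import Induction.WellFounded using (WellFounded; Acc; acc; module Subrelation)
open import Relation.Binary.Construct.On as On using ()
open import Relation.Binary.PropositionalEquality using (_≡_; sym; trans; cong)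
open import Relation.Nullary using (¬_)

pieces : Position → ℕ
pieces (a , b) = a + b

move-decreases-pieces : ∀ {p q} → Move p q → pieces q < pieces p
move-decreases-pieces (merge {a} {b}) = s≤s (≤-reflexive (+-suc a b))
move-decreases-pieces (add {a} {b}) = m<n⇒m<1+n (+-monoʳ-< a (n<1+n b))
move-decreases-pieces (split {a} {b}) =
  ≤-reflexive (sym (trans (+-suc a (suc b)) (cong suc (+-suc a b))))

_⊏_ : Position → Position → Set
q ⊏ p = Move p q

⊏-wellFounded : WellFounded _⊏_
⊏-wellFounded =
  Subrelation.wellFounded move-decreases-pieces (On.wellFounded pieces <-wellFounded)

module KernelIsP
  (K : Position → Set)
  (independent : ∀ {p q} → Move p q → K p → ¬ K q)
  (absorbing : ∀ p → K p ⊎ ∃[ q ] Move p q × K q)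
  where

  kernel⇒IsP-acc : ∀ {p} → Acc _⊏_ p → K p → IsP p
  non-kernel⇒IsN-acc : ∀ {p} → Acc _⊏_ p → ¬ K p → IsN p

  kernel⇒IsP-acc (acc rs) kp = isP λ m → non-kernel⇒IsN-acc (rs m) (independent m kp)

  non-kernel⇒IsN-acc {p} (acc rs) ¬kp with absorbing p
  ... | inj₁ kp = ⊥-elim (¬kp kp)
  ... | inj₂ (q , m , kq) = isN m (kernel⇒IsP-acc (rs m) kq)

  non-kernel⇒IsN : ∀ p → ¬ K p → IsN p
  non-kernel⇒IsN p = non-kernel⇒IsN-acc (⊏-wellFounded p)

data KernelResidues : ℕ → ℕ → Set where
  0-0 : KernelResidues 0 0
  0-1 : KernelResidues 0 1
  1-0 : KernelResidues 1 0

-- (3 + n) % 3 reduces to n % 3 definitionally; the recursions in kernel-absorbing and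
-- kernel-independent, which strip 3 from a column, rely on this.
Kernel : Position → Set
Kernel (a , b) = KernelResidues (a % 3) (b % 3)

Move-translateˡ : ∀ k {a b a′ b′} → Move (a , b) (a′ , b′) → Move (k + a , b) (k + a′ , b′)
Move-translateˡ k (merge {a}) rewrite +-suc k (suc a) | +-suc k a = merge
Move-translateˡ k (add {a}) rewrite +-suc k a = add
Move-translateˡ k (split {a}) rewrite +-suc k a = split

Move-translateʳ : ∀ k {a b a′ b′} → Move (a , b) (a′ , b′) → Move (a , k + b) (a′ , k + b′)
Move-translateʳ k (merge {b = b}) rewrite +-suc k b = merge
Move-translateʳ k (add {b = b}) rewrite +-suc k b = add
Move-translateʳ k (split {b = b}) rewrite +-suc k (suc b) | +-suc k b = split

kernel-absorbing : ∀ p → Kernel p ⊎ ∃[ q ] Move p q × Kernel q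
kernel-absorbing (suc (suc (suc a)) , b) =
  Sum.map₂ (λ { ((a′ , b′) , m , k) → (3 + a′ , b′) , Move-translateˡ 3 m , k })
           (kernel-absorbing (a , b))
kernel-absorbing (a , suc (suc (suc b))) =
  Sum.map₂ (λ { ((a′ , b′) , m , k) → (a′ , 3 + b′) , Move-translateʳ 3 m , k })
           (kernel-absorbing (a , b))
kernel-absorbing (0 , 0) = inj₁ 0-0
kernel-absorbing (0 , 1) = inj₁ 0-1
kernel-absorbing (1 , 0) = inj₁ 1-0
kernel-absorbing (0 , 2) = inj₂ (_ , split , 1-0)
kernel-absorbing (1 , 1) = inj₂ (_ , add , 0-0)
kernel-absorbing (1 , 2) = inj₂ (_ , add , 0-1)
kernel-absorbing (2 , 0) = inj₂ (_ , merge , 0-1)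
kernel-absorbing (2 , 1) = inj₂ (_ , add , 1-0)
kernel-absorbing (2 , 2) = inj₂ (_ , merge , 0-0)

kernel-independent : ∀ {p q} → Move p q → Kernel p → ¬ Kernel q
kernel-independent (merge {suc (suc (suc a))} {b}) = kernel-independent (merge {a} {b})
kernel-independent (merge {a} {suc (suc (suc b))}) = kernel-independent (merge {a} {b})
kernel-independent (merge {0}) ()
kernel-independent (merge {1} {0}) _ ()
kernel-independent (merge {1} {1}) _ ()
kernel-independent (merge {1} {2}) ()
kernel-independent (merge {2}) _ ()
kernel-independent (add {suc (suc (suc a))} {b}) = kernel-independent (add {a} {b})
kernel-independent (add {a} {suc (suc (suc b))}) = kernel-independent (add {a} {b})
kernel-independent (add {0} {0}) ()
kernel-independent (add {0} {1}) ()
kernel-independent (add {0} {2}) _ ()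
kernel-independent (add {1}) ()
kernel-independent (add {2}) _ ()
kernel-independent (split {suc (suc (suc a))} {b}) = kernel-independent (split {a} {b})
kernel-independent (split {a} {suc (suc (suc b))}) = kernel-independent (split {a} {b})
kernel-independent (split {b = 0}) ()
kernel-independent (split {0} {1}) _ ()
kernel-independent (split {1} {1}) _ ()
kernel-independent (split {2} {1}) ()
kernel-independent (split {b = 2}) _ ()

residue-2-outside-kernelˡ : ∀ a b → a % 3 ≡ 2 → ¬ Kernel (a , b)
residue-2-outside-kernelˡ _ _ a%3≡2 rewrite a%3≡2 = λ ()

residue-2-outside-kernelʳ : ∀ a b → b % 3 ≡ 2 → ¬ Kernel (a , b)
residue-2-outside-kernelʳ _ _ b%3≡2 rewrite b%3≡2 = λ ()

open KernelIsP Kernel kernel-independent kernel-absorbing using (non-kernel⇒IsN)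

theorem4p2 : ((a : ℕ) → a % 3 ≡ 2 → IsN (a , 0))
             × ((b : ℕ) → b % 3 ≡ 2 → IsN (0 , b))
theorem4p2 =
  (λ a a%3≡2 → non-kernel⇒IsN (a , 0) (residue-2-outside-kernelˡ a 0 a%3≡2)) ,
  (λ b b%3≡2 → non-kernel⇒IsN (0 , b) (residue-2-outside-kernelʳ 0 b b%3≡2))
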